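{- Let $v$ be a Krull valuation of arbitrary rank on a field $\mathbb{K}$, with value group $G_v=v(\mathbb{K}^\times)$. Let $f=a_0+a_1 z+\cdots+a_n z^n \in \mathbb{K}[z]$ be a polynomial of degree $n$. Suppose there exist smallest indices $j$ and $k$ with $1\leq k+1\leq j\leq n$ for which the following conditions are satisfied: (i) $v(a_j)=0$; (ii) $\frac{v(a_k)}{j-k}<\frac{v(a_i)}{j-i}$ for all indices $i$ with $0\leq i\leq j-1$ and $i\neq k$; (iii) if $j<n$, then $\frac{v(a_k)}{j-k}>\frac{v(a_i)}{j-i}$ for all indices $i$ with $j+1\leq i\leq n$; (iv) $v(a_k)\notin dG_v$ for any positive divisor $d>1$ of $j-k$. Then any factorization $f(z)=f_1(z)f_2(z)$ of $f$ in $\mathbb{K}[z]$ has a factor of degree $\leq n-j+k$. In particular, if $j=n$ and $k=0$, then $f$ is irreducible in $\mathbb{K}[z]$.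
   Context: A Krull valuation on $\mathbb{K}$ is a surjective map $v:\mathbb{K}\to G_v\cup\{\infty\}$, where $G_v$ is a totally ordered abelian group, such that $v(x)=\infty$ iff $x=0$, $v(xy)=v(x)+v(y)$, and $v(x+y)\geq\min\{v(x),v(y)\}$; here $\infty$ exceeds every element and absorbs addition. Quotients such as $\frac{v(a_i)}{m}$ (for a positive or negative integer $m$) are taken in a totally ordered abelian group containing $G_v$ in which such divisions are possible (e.g. the divisible hull $G_v\otimes\mathbb{Q}$ with its induced order), with the convention $\infty/m=\infty$. For a positive integer $d$, $dG_v=\{dg: g\in G_v\}$. -}

module Defs where

open import Level using (Level; _⊔_) renaming (suc to lsuc)
open import Algebra.Bundles using (CommutativeRing; AbelianGroup)
open import Relation.Binary.Structures using (IsTotalOrder)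
open import Data.Nat using (ℕ; zero; suc; _<_; _≤_; _∸_; _<?_)
open import Data.Nat.Divisibility using (_∣_)
open import Data.Integer using (ℤ; +_; -[1+_]; _⊖_)
open import Data.Fin using (Fin; fromℕ; fromℕ<)
open import Data.Product using (Σ; ∃; _×_; _,_)
open import Data.Sum using (_⊎_)
open import Data.Unit.Polymorphic using (⊤)
open import Data.Empty.Polymorphic using (⊥)
open import Relation.Nullary using (¬_; yes; no)
open import Relation.Binary.PropositionalEquality using (_≡_)

record Field (c ℓ : Level) : Set (lsuc (c ⊔ ℓ)) where
  field
    commutativeRing : CommutativeRing c ℓ
  open CommutativeRing commutativeRing public
  field
    1≉0 : ¬ (1# ≈ 0#)
    inverse : ∀ x → ¬ (x ≈ 0#) → ∃ λ y → (x * y) ≈ 1#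

-- Totally ordered abelian groups (written additively: _∙_ is +, ε is 0).

record OrderedAbelianGroup (g ℓ o : Level) : Set (lsuc (g ⊔ ℓ ⊔ o)) where
  field
    abelianGroup : AbelianGroup g ℓ
  open AbelianGroup abelianGroup public
  field
    _≤ᵍ_ : Carrier → Carrier → Set o
    isTotalOrder : IsTotalOrder _≈_ _≤ᵍ_
    ≤-translation : ∀ a b c → a ≤ᵍ b → (a ∙ c) ≤ᵍ (b ∙ c)

  _<ᵍ_ : Carrier → Carrier → Set (ℓ ⊔ o)
  a <ᵍ b = (a ≤ᵍ b) × ¬ (a ≈ b)

  _·_ : ℕ → Carrier → Carrier
  zero · x = ε
  suc n · x = x ∙ (n · x)

module _ {g ℓ o : Level} (G : OrderedAbelianGroup g ℓ o) where
  open OrderedAbelianGroup G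

  data G∞ : Set g where
    fin : Carrier → G∞
    ∞   : G∞

  _≈∞_ : G∞ → G∞ → Set ℓ
  fin x ≈∞ fin y = x ≈ y
  fin x ≈∞ ∞     = ⊥
  ∞     ≈∞ fin y = ⊥
  ∞     ≈∞ ∞     = ⊤

  _≤∞_ : G∞ → G∞ → Set o
  fin x ≤∞ fin y = x ≤ᵍ y
  fin x ≤∞ ∞     = ⊤
  ∞     ≤∞ fin y = ⊥
  ∞     ≤∞ ∞     = ⊤

  _+∞_ : G∞ → G∞ → G∞
  fin x +∞ fin y = fin (x ∙ y)
  fin x +∞ ∞     = ∞
  ∞     +∞ _     = ∞

  -- Quotients x/m (m a nonzero integer) in the divisible hull G ⊗ ℚ.
  -- hfin x p  represents  x / (1 + p)  (positive denominator);
  -- h∞ represents ∞.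
  data Hull : Set g where
    hfin : Carrier → ℕ → Hull
    h∞   : Hull

  -- x/m with the convention ∞/m = ∞;  x/(-(1+p)) = (x⁻¹)/(1+p).
  -- (The case m = 0 is never used; it is sent to h∞ as a junk value.)
  _÷_ : G∞ → ℤ → Hull
  ∞     ÷ m         = h∞
  fin x ÷ (+ zero)  = h∞
  fin x ÷ (+ suc p) = hfin x p
  fin x ÷ -[1+ p ]  = hfin (x ⁻¹) p

  _<ʰ_ : Hull → Hull → Set (ℓ ⊔ o)
  hfin x p <ʰ hfin y q = (suc q · x) <ᵍ (suc p · y)
  hfin x p <ʰ h∞       = ⊤
  h∞       <ʰ _        = ⊥

record Valuation {c ℓ g ℓg o : Level} (F : Field c ℓ)
                 (G : OrderedAbelianGroup g ℓg o)
                 : Set (c ⊔ ℓ ⊔ g ⊔ ℓg ⊔ o) where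
  private
    module F = Field F
  field
    v : F.Carrier → G∞ G
    v-cong : ∀ {x y} → x F.≈ y → _≈∞_ G (v x) (v y)
    v-∞⇒0 : ∀ x → _≈∞_ G (v x) ∞ → x F.≈ F.0#
    v-0⇒∞ : ∀ x → x F.≈ F.0# → _≈∞_ G (v x) ∞
    v-mul : ∀ x y → _≈∞_ G (v (x F.* y)) (_+∞_ G (v x) (v y))
    v-add : ∀ x y → _≤∞_ G (v x) (v (x F.+ y)) ⊎ _≤∞_ G (v y) (v (x F.+ y))
    v-surjective : ∀ γ → ∃ λ x → _≈∞_ G (v x) γ

module _ {c ℓ : Level} (F : Field c ℓ) where
  open Field F using (Carrier; _≈_; _+_; _*_; 0#)

  Poly : ℕ → Set c
  Poly d = Fin (suc d) → Carrier

  HasDegree : (d : ℕ) → Poly d → Set ℓ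
  HasDegree d p = ¬ (p (fromℕ d) ≈ 0#)

  coeff : ∀ {d} → Poly d → ℕ → Carrier
  coeff {d} p i with i <? suc d
  ... | yes i<d = p (fromℕ< i<d)
  ... | no _    = 0#

  sumTo : (ℕ → Carrier) → ℕ → Carrier
  sumTo f zero    = f zero
  sumTo f (suc m) = sumTo f m + f (suc m)

  mulCoeff : ∀ {d e} → Poly d → Poly e → ℕ → Carrier
  mulCoeff p q m = sumTo (λ i → coeff p i * coeff q (m ∸ i)) m

  IsProduct : ∀ {n d e} → Poly n → Poly d → Poly e → Set ℓ
  IsProduct f p q = ∀ m → coeff f m ≈ mulCoeff p q m

  -- Irreducible in K[z]: not a unit (degree ≥ 1), and in every
  -- factorisation f = f₁ f₂ one factor is a unit (a nonzero constant).
  Irreducible : (n : ℕ) → Poly n → Set (c ⊔ ℓ)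
  Irreducible n f =
    (1 ≤ n) ×
    (∀ d₁ (f₁ : Poly d₁) d₂ (f₂ : Poly d₂) →
       HasDegree d₁ f₁ → HasDegree d₂ f₂ → IsProduct f f₁ f₂ →
       (d₁ ≡ 0) ⊎ (d₂ ≡ 0))

module _ {c ℓ g ℓg o : Level} {F : Field c ℓ}
         {G : OrderedAbelianGroup g ℓg o} (val : Valuation F G) where
  open Valuation val
  open OrderedAbelianGroup G using (ε; _·_)

  Conditions : (n : ℕ) → Poly F n → ℕ → ℕ → Set (g ⊔ ℓg ⊔ o)
  Conditions n f j k =
    (k < j) × (j ≤ n) ×
    _≈∞_ G (v (a j)) (fin ε) ×
    (∀ i → i < j → ¬ (i ≡ k) →
       _<ʰ_ G (_÷_ G (v (a k)) (j ⊖ k)) (_÷_ G (v (a i)) (j ⊖ i))) ×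
    (j < n → ∀ i → j < i → i ≤ n →
       _<ʰ_ G (_÷_ G (v (a i)) (j ⊖ i)) (_÷_ G (v (a k)) (j ⊖ k))) ×
    (∀ d → d ∣ (j ∸ k) → 1 < d → ¬ (∃ λ γ → _≈∞_ G (v (a k)) (fin (d · γ))))
    where
      a : ℕ → Field.Carrier F
      a = coeff F f

  Smallest : (n : ℕ) → Poly F n → ℕ → ℕ → Set (g ⊔ ℓg ⊔ o)
  Smallest n f j k =
    Conditions n f j k ×
    (∀ j′ k′ → Conditions n f j′ k′ → (j ≤ j′) × (j ≡ j′ → k ≤ k′))

-- Fix x = v(a_k) and m = j − k, and give the coefficient c of z^i the weight m·v(c) + i·x: this is
-- j·x plus m times the height of the point (i, v(c)) above the line through (k, v(a_k)) and (j, 0).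
-- Conditions (i)–(iii) say that the weights of f are minimal exactly at k and at j. Weights are
-- additive on products of coefficients, so, as for Newton polygons, the first and the last index at
-- which the weights of f₁f₂ are minimal are the sums s₁ + s₂ and t₁ + t₂ of the corresponding
-- indices of f₁ and f₂. Hence k = s₁ + s₂ and j = t₁ + t₂, so lᵢ = tᵢ − sᵢ satisfy l₁ + l₂ = m, and
-- equating the two minimal weights of f₁ gives l₁·x ∈ mG. If 0 < l₁ < m, Bézout yields
-- gcd(l₁, m)·x ∈ mG, so x ∈ (m / gcd(l₁, m))G, against (iv). Thus some lᵢ = m, that factor has
-- degree at least m, and the other one has degree at most n − m. The minima are only obtained under
-- double negation, which suffices because the conclusion is decidable.

module Submission where

open import Defs
open import Level using (Level; _⊔_)
open import Relation.Binary.Structures using (IsEquivalence)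
open import Relation.Binary.Definitions using (tri<; tri≈; tri>)
open import Relation.Binary.Bundles using (TotalOrder; Setoid)
import Relation.Binary.Reasoning.Setoid
open import Data.Nat using (ℕ; zero; suc; _≤_; _<_; _∸_; _+_; _*_; z≤n; s≤s; _≤?_; _<?_; _≟_; >-nonZero)
import Data.Nat.Properties as ℕ
import Algebra.Properties.CommutativeSemigroup ℕ.+-commutativeSemigroup as ℕ+
open import Data.Product using (∃; ∃₂; _×_; _,_; proj₁; proj₂)
open import Data.Sum as Sum using (_⊎_; inj₁; inj₂)
open import Data.Empty using (⊥-elim)
open import Data.Fin.Properties using (fromℕ-def)
open import Data.Integer using (+_; -[1+_]; _⊖_; -_)
import Data.Integer.Properties as ℤ
open import Relation.Nullary using (¬_; yes; no; ¬¬-excluded-middle)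
open import Relation.Nullary.Decidable using (decidable-stable; _⊎-dec_)
open import Function using (_∘_; flip)
open import Relation.Binary.PropositionalEquality as ≡ using (_≡_; _≢_)
open import Relation.Nullary.Construct.Add.Supremum using (_⁺; ⊤⁺; [_])

<⇒<+∸ : ∀ {i a b} → i < a → b < a + b ∸ i
<⇒<+∸ {b = b} i<a = ≡.subst (b <_) (≡.sym (ℕ.+-∸-comm b (ℕ.<⇒≤ i<a))) (ℕ.m<n+m b (ℕ.m<n⇒0<n∸m i<a))

≢⇒<⊎> : ∀ {i j} → i ≢ j → i < j ⊎ j < i
≢⇒<⊎> {i} {j} i≢j with ℕ.<-cmp i j
... | tri< i<j _ _ = inj₁ i<j
... | tri≈ _ i≡j _ = ⊥-elim (i≢j i≡j)
... | tri> _ _ j<i = inj₂ j<i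

split-below : ∀ {i r a b} → i ≤ r → r < a + b → i < a ⊎ r ∸ i < b
split-below {i} {r} {a} {b} i≤r r<a+b with i <? a | r ∸ i <? b
... | yes i<a | _       = inj₁ i<a
... | no  _   | yes <b  = inj₂ <b
... | no  i≮a | no  ≮b  = ⊥-elim (ℕ.<⇒≱ r<a+b
      (≡.subst (a + b ≤_) (ℕ.m+[n∸m]≡n i≤r) (ℕ.+-mono-≤ (ℕ.≮⇒≥ i≮a) (ℕ.≮⇒≥ ≮b))))

split-above : ∀ {i r a b} → i ≤ r → a + b < r → a < i ⊎ b < r ∸ i
split-above {i} {r} {a} {b} i≤r a+b<r with a <? i | b <? r ∸ i
... | yes a<i | _       = inj₁ a<i
... | no  _   | yes b<  = inj₂ b<
... | no  a≮i | no  b≮  = ⊥-elim (ℕ.<⇒≱ a+b<r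
      (≡.subst (_≤ a + b) (ℕ.m+[n∸m]≡n i≤r) (ℕ.+-mono-≤ (ℕ.≮⇒≥ a≮i) (ℕ.≮⇒≥ b≮))))

>⇒+∸< : ∀ {i a b} → a < i → i ≤ a + b → a + b ∸ i < b
>⇒+∸< {i} {a} {b} a<i i≤a+b = ℕ.+-cancelˡ-< a _ _
  (≡.subst (a + (a + b ∸ i) <_) (ℕ.m+[n∸m]≡n i≤a+b) (ℕ.+-monoˡ-< (a + b ∸ i) a<i))

other-index : ∀ {k j} → suc k < j → ∃ λ i → i < j × i ≢ k
other-index {zero}  1<j   = 1 , 1<j , λ ()
other-index {suc _} 2+k≤j = 0 , ℕ.≤-trans (s≤s z≤n) (ℕ.<⇒≤ 2+k≤j) , λ ()

≤-suc-cases : ∀ {p d} {P : ℕ → Set p} → (∀ i → i ≤ d → P i) → P (suc d) → ∀ i → i ≤ suc d → P i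
≤-suc-cases P≤d P-suc i i≤1+d with ℕ.m≤n⇒m<n∨m≡n i≤1+d
... | inj₁ i<1+d  = P≤d i (ℕ.≤-pred i<1+d)
... | inj₂ ≡.refl = P-suc

⊖-pos : ∀ {q i j} → suc q + i ≡ j → j ⊖ i ≡ + suc q
⊖-pos {q} {i} ≡.refl = ≡.trans (ℤ.⊖-≥ (ℕ.m≤n+m i (suc q))) (≡.cong +_ (ℕ.m+n∸n≡m (suc q) i))

⊖-neg : ∀ {q i j} → suc q + j ≡ i → j ⊖ i ≡ -[1+ q ]
⊖-neg {q} {i} {j} eq = ≡.trans (ℤ.⊖-swap j i) (≡.cong -_ (⊖-pos eq))

suc[∸suc]+≡ : ∀ {i j} → i < j → suc (j ∸ suc i) + i ≡ j
suc[∸suc]+≡ {i} {j} i<j = ≡.trans (≡.sym (ℕ.+-suc (j ∸ suc i) i)) (ℕ.m∸n+n≡m i<j)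

degree-bound : ∀ {n j k m d₁ d₂} → d₁ + d₂ ≤ n → m + k ≡ j → j ≤ n → m ≤ d₂ →
               d₁ ≤ n ∸ j + k
degree-bound {n} {j} {k} {m} {d₁} {d₂} d₁+d₂≤n m+k≡j j≤n m≤d₂ = ℕ.+-cancelˡ-≤ m d₁ (n ∸ j + k) (begin
  m + d₁           ≤⟨ ℕ.+-monoˡ-≤ d₁ m≤d₂ ⟩
  d₂ + d₁          ≡⟨ ℕ.+-comm d₂ d₁ ⟩
  d₁ + d₂          ≤⟨ d₁+d₂≤n ⟩
  n                ≡⟨ ℕ.m∸n+n≡m j≤n ⟨
  n ∸ j + j        ≡⟨ ≡.cong (_+_ (n ∸ j)) (≡.trans (ℕ.+-comm k m) m+k≡j) ⟨
  n ∸ j + (k + m)  ≡⟨ ℕ.+-assoc (n ∸ j) k m ⟨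
  n ∸ j + k + m    ≡⟨ ℕ.+-comm (n ∸ j + k) m ⟩
  m + (n ∸ j + k)  ∎)
  where open ℕ.≤-Reasoning

∸-distrib-+ : ∀ {s₁ t₁ s₂ t₂} → s₁ ≤ t₁ → s₂ ≤ t₂ →
              t₁ + t₂ ∸ (s₁ + s₂) ≡ (t₁ ∸ s₁) + (t₂ ∸ s₂)
∸-distrib-+ {s₁} {t₁} {s₂} {t₂} s₁≤t₁ s₂≤t₂ = begin
  t₁ + t₂ ∸ (s₁ + s₂)              ≡⟨ ≡.cong₂ (λ a b → a + b ∸ (s₁ + s₂))
                                               (ℕ.m+[n∸m]≡n s₁≤t₁) (ℕ.m+[n∸m]≡n s₂≤t₂) ⟨
  s₁ + l₁ + (s₂ + l₂) ∸ (s₁ + s₂)  ≡⟨ ≡.cong (_∸ (s₁ + s₂)) (ℕ+.interchange s₁ l₁ s₂ l₂) ⟩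
  s₁ + s₂ + (l₁ + l₂) ∸ (s₁ + s₂)  ≡⟨ ℕ.m+n∸m≡n (s₁ + s₂) (l₁ + l₂) ⟩
  l₁ + l₂                          ∎
  where
  open ≡.≡-Reasoning
  l₁ = t₁ ∸ s₁
  l₂ = t₂ ∸ s₂

module OrderedGroupProperties {g ℓ o : Level} (G : OrderedAbelianGroup g ℓ o) where
  open OrderedAbelianGroup G public
  open import Algebra.Properties.AbelianGroup abelianGroup public
    using (∙-cancelʳ; inverseʳ-unique)
  open import Algebra.Properties.CommutativeSemigroup commutativeSemigroup public
    using (interchange; x∙yz≈y∙xz)
  open import Algebra.Properties.CommutativeMonoid.Mult commutativeMonoid
    using (×-homo-+; ×-assocˡ; ×-distrib-+; ×-congʳ) renaming (_×_ to _×′_)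

  module ≈-Reasoning = Relation.Binary.Reasoning.Setoid setoid

  totalOrder : TotalOrder g ℓ o
  totalOrder = record { isTotalOrder = isTotalOrder }

  open TotalOrder totalOrder public
    using (poset; total; antisym; ≤-respˡ-≈; ≤-respʳ-≈)
    renaming (refl to ≤-refl; trans to ≤-trans; reflexive to ≤-reflexive)
  open import Relation.Binary.Properties.Poset poset public
    using (<-resp-≈; <-respˡ-≈; <-respʳ-≈; <-irrefl; <⇒≱)
  import Relation.Binary.Construct.NonStrictToStrict _≈_ _≤ᵍ_ as Strict

  <⇒≤ : ∀ {a b} → a <ᵍ b → a ≤ᵍ b
  <⇒≤ = proj₁

  <-≤-trans : ∀ {a b c} → a <ᵍ b → b ≤ᵍ c → a <ᵍ c
  <-≤-trans = Strict.<-≤-trans sym ≤-trans antisym ≤-respʳ-≈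

  ∙-monoˡ-≤ : ∀ c {a b} → a ≤ᵍ b → (a ∙ c) ≤ᵍ (b ∙ c)
  ∙-monoˡ-≤ c = ≤-translation _ _ c

  ∙-monoʳ-≤ : ∀ c {a b} → a ≤ᵍ b → (c ∙ a) ≤ᵍ (c ∙ b)
  ∙-monoʳ-≤ c a≤b = ≤-respʳ-≈ (comm _ c) (≤-respˡ-≈ (comm _ c) (∙-monoˡ-≤ c a≤b))

  ∙-mono-≤ : ∀ {a b c d} → a ≤ᵍ b → c ≤ᵍ d → (a ∙ c) ≤ᵍ (b ∙ d)
  ∙-mono-≤ a≤b c≤d = ≤-trans (∙-monoˡ-≤ _ a≤b) (∙-monoʳ-≤ _ c≤d)

  ∙-cancelʳ-≤ : ∀ c {a b} → (a ∙ c) ≤ᵍ (b ∙ c) → a ≤ᵍ b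
  ∙-cancelʳ-≤ c {a} {b} ac≤bc =
    ≤-respʳ-≈ (cancel b) (≤-respˡ-≈ (cancel a) (∙-monoˡ-≤ (c ⁻¹) ac≤bc))
    where
    cancel : ∀ x → (x ∙ c) ∙ c ⁻¹ ≈ x
    cancel x = trans (assoc x c (c ⁻¹)) (trans (∙-congˡ (inverseʳ c)) (identityʳ x))

  ∙-mono-<-≤ : ∀ {a b c d} → a <ᵍ b → c ≤ᵍ d → (a ∙ c) <ᵍ (b ∙ d)
  ∙-mono-<-≤ {b = b} {c} (a≤b , a≉b) c≤d = ∙-mono-≤ a≤b c≤d , λ ac≈bd →
    a≉b (antisym a≤b (∙-cancelʳ-≤ c (≤-trans (∙-monoʳ-≤ b c≤d) (≤-reflexive (sym ac≈bd)))))

  ∙-cancelʳ-< : ∀ c {a b} → (a ∙ c) <ᵍ (b ∙ c) → a <ᵍ b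
  ∙-cancelʳ-< c (ac≤bc , ac≉bc) = ∙-cancelʳ-≤ c ac≤bc , λ a≈b → ac≉bc (∙-congʳ a≈b)

  x∙x≈ε⇒x≈ε : ∀ {x} → x ∙ x ≈ ε → x ≈ ε
  x∙x≈ε⇒x≈ε {x} xx≈ε with total x ε
  ... | inj₁ x≤ε = antisym x≤ε (≤-respˡ-≈ xx≈ε (≤-respʳ-≈ (identityʳ x) (∙-monoʳ-≤ x x≤ε)))
  ... | inj₂ ε≤x = antisym (≤-respʳ-≈ xx≈ε (≤-respˡ-≈ (identityʳ x) (∙-monoʳ-≤ x ε≤x))) ε≤x

  ·≈×′ : ∀ n x → n · x ≈ n ×′ x
  ·≈×′ zero    x = refl
  ·≈×′ (suc n) x = ∙-congˡ (·≈×′ n x)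

  ·-congʳ : ∀ n {x y} → x ≈ y → n · x ≈ n · y
  ·-congʳ n {x} {y} x≈y = trans (·≈×′ n x) (trans (×-congʳ n x≈y) (sym (·≈×′ n y)))

  ·-congˡ : ∀ {m n} x → m ≡ n → m · x ≈ n · x
  ·-congˡ x ≡.refl = refl

  ·-homo-+ : ∀ x m n → (m + n) · x ≈ m · x ∙ n · x
  ·-homo-+ x m n = begin
    (m + n) · x      ≈⟨ ·≈×′ (m + n) x ⟩
    (m + n) ×′ x     ≈⟨ ×-homo-+ x m n ⟩
    m ×′ x ∙ n ×′ x  ≈⟨ ∙-cong (·≈×′ m x) (·≈×′ n x) ⟨
    m · x ∙ n · x    ∎
    where open ≈-Reasoning

  ·-assocˡ : ∀ x m n → m · (n · x) ≈ (m * n) · x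
  ·-assocˡ x m n = begin
    m · (n · x)    ≈⟨ ·-congʳ m (·≈×′ n x) ⟩
    m · (n ×′ x)   ≈⟨ ·≈×′ m (n ×′ x) ⟩
    m ×′ (n ×′ x)  ≈⟨ ×-assocˡ x m n ⟩
    (m * n) ×′ x   ≈⟨ ·≈×′ (m * n) x ⟨
    (m * n) · x    ∎
    where open ≈-Reasoning

  ·-comm : ∀ x m n → m · (n · x) ≈ n · (m · x)
  ·-comm x m n = trans (·-assocˡ x m n) (trans (·-congˡ x (ℕ.*-comm m n)) (sym (·-assocˡ x n m)))

  ·-distrib-∙ : ∀ n x y → n · (x ∙ y) ≈ n · x ∙ n · y
  ·-distrib-∙ n x y = begin
    n · (x ∙ y)      ≈⟨ ·≈×′ n (x ∙ y) ⟩
    n ×′ (x ∙ y)     ≈⟨ ×-distrib-+ x y n ⟩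
    n ×′ x ∙ n ×′ y  ≈⟨ ∙-cong (·≈×′ n x) (·≈×′ n y) ⟨
    n · x ∙ n · y    ∎
    where open ≈-Reasoning

  ·-zeroʳ : ∀ n → n · ε ≈ ε
  ·-zeroʳ zero    = refl
  ·-zeroʳ (suc n) = trans (identityˡ (n · ε)) (·-zeroʳ n)

  ·-homo-⁻¹ : ∀ n x → n · (x ⁻¹) ≈ (n · x) ⁻¹
  ·-homo-⁻¹ n x = inverseʳ-unique (n · x) (n · (x ⁻¹)) (begin
    n · x ∙ n · (x ⁻¹)  ≈⟨ ·-distrib-∙ n x (x ⁻¹) ⟨
    n · (x ∙ x ⁻¹)      ≈⟨ ·-congʳ n (inverseʳ x) ⟩
    n · ε               ≈⟨ ·-zeroʳ n ⟩
    ε                   ∎)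
    where open ≈-Reasoning

  ·-mono-≤ : ∀ n {x y} → x ≤ᵍ y → (n · x) ≤ᵍ (n · y)
  ·-mono-≤ zero    x≤y = ≤-refl
  ·-mono-≤ (suc n) x≤y = ∙-mono-≤ x≤y (·-mono-≤ n x≤y)

  ·-mono-< : ∀ n {x y} → x <ᵍ y → (suc n · x) <ᵍ (suc n · y)
  ·-mono-< n x<y = ∙-mono-<-≤ x<y (·-mono-≤ n (<⇒≤ x<y))

  ·-cancel-< : ∀ n {x y} → (suc n · x) <ᵍ (suc n · y) → x <ᵍ y
  ·-cancel-< n {x} {y} nx<ny with total x y
  ... | inj₁ x≤y = x≤y , λ x≈y → proj₂ nx<ny (·-congʳ (suc n) x≈y)
  ... | inj₂ y≤x = ⊥-elim (<⇒≱ nx<ny (·-mono-≤ (suc n) y≤x))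

  ·-cancel-≈ : ∀ n {x y} → suc n · x ≈ suc n · y → ¬ ¬ (x ≈ y)
  ·-cancel-≈ n {x} {y} nx≈ny x≉y with total x y
  ... | inj₁ x≤y = <-irrefl nx≈ny (·-mono-< n (x≤y , x≉y))
  ... | inj₂ y≤x = <-irrefl (sym nx≈ny) (·-mono-< n (y≤x , x≉y ∘ sym))

module ExtendedGroupProperties {g ℓ o : Level} (G : OrderedAbelianGroup g ℓ o) where
  open OrderedGroupProperties G

  open import Relation.Binary.Construct.Add.Supremum.Equality _≈_ public
    using (_≈⁺_; ⊤⁺≈⊤⁺; [_]; [≈]-injective; ≈⁺-isEquivalence)
  open import Relation.Binary.Construct.Add.Supremum.NonStrict _≤ᵍ_ public
    using (_≤⁺_; [_]; _≤⊤⁺; ≤⁺-isTotalOrder)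
  open import Relation.Binary.Construct.Add.Supremum.Strict _<ᵍ_ public
    using (_<⁺_; [_]; [_]<⊤⁺; <⁺-transˡ; <⁺-irrefl; <⁺-resp-≈⁺)

  totalOrder⁺ : TotalOrder g (g ⊔ ℓ) (g ⊔ o)
  totalOrder⁺ = record { isTotalOrder = ≤⁺-isTotalOrder isTotalOrder }

  open TotalOrder totalOrder⁺ public
    using ()
    renaming ( total to ≤⁺-total; antisym to ≤⁺-antisym; refl to ≤⁺-refl
             ; trans to ≤⁺-trans; reflexive to ≤⁺-reflexive)

  setoid⁺ : Setoid g (g ⊔ ℓ)
  setoid⁺ = record { isEquivalence = ≈⁺-isEquivalence isEquivalence }

  module ≈⁺-Reasoning = Relation.Binary.Reasoning.Setoid setoid⁺

  open IsEquivalence (≈⁺-isEquivalence isEquivalence) public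
    using () renaming (refl to ≈⁺-refl; sym to ≈⁺-sym; trans to ≈⁺-trans; reflexive to ≈⁺-reflexive)

  <⁺⇒≤⁺ : ∀ {X Y} → X <⁺ Y → X ≤⁺ Y
  <⁺⇒≤⁺ [ a<b ]    = [ <⇒≤ a<b ]
  <⁺⇒≤⁺ [ a ]<⊤⁺   = [ a ] ≤⊤⁺

  <⁺-≤⁺-trans : ∀ {X Y Z} → X <⁺ Y → Y ≤⁺ Z → X <⁺ Z
  <⁺-≤⁺-trans = <⁺-transˡ <-≤-trans

  <⁺-respˡ-≈⁺ : ∀ {X Y Z} → X ≈⁺ Y → X <⁺ Z → Y <⁺ Z
  <⁺-respˡ-≈⁺ = proj₂ (<⁺-resp-≈⁺ <-resp-≈)

  <⁺-respʳ-≈⁺ : ∀ {X Y Z} → Y ≈⁺ Z → X <⁺ Y → X <⁺ Z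
  <⁺-respʳ-≈⁺ = proj₁ (<⁺-resp-≈⁺ <-resp-≈)

  ≤⁺∧≉⁺⇒<⁺ : ∀ {X Y} → ¬ (X ≈⁺ Y) → X ≤⁺ Y → X <⁺ Y
  ≤⁺∧≉⁺⇒<⁺ X≉Y [ a≤b ]      = [ (a≤b , X≉Y ∘ [_]) ]
  ≤⁺∧≉⁺⇒<⁺ X≉Y ([ a ] ≤⊤⁺)  = [ a ]<⊤⁺
  ≤⁺∧≉⁺⇒<⁺ X≉Y (⊤⁺ ≤⊤⁺)     = ⊥-elim (X≉Y ⊤⁺≈⊤⁺)

  <⁺⇒≱⁺ : ∀ {X Y} → X <⁺ Y → ¬ (Y ≤⁺ X)
  <⁺⇒≱⁺ X<Y Y≤X = <⁺-irrefl <-irrefl ≈⁺-refl (<⁺-≤⁺-trans X<Y Y≤X)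

  <⁺⇒≉⁺ : ∀ {X Y} → X <⁺ Y → ¬ (X ≈⁺ Y)
  <⁺⇒≉⁺ X<Y X≈Y = <⁺⇒≱⁺ X<Y (≤⁺-reflexive (≈⁺-sym X≈Y))

  infixl 6 _+⁺_
  infixr 8 _·⁺_

  _+⁺_ : Carrier ⁺ → Carrier ⁺ → Carrier ⁺
  [ a ] +⁺ [ b ] = [ a ∙ b ]
  _     +⁺ _     = ⊤⁺

  _·⁺_ : ℕ → Carrier ⁺ → Carrier ⁺
  n ·⁺ [ a ] = [ n · a ]
  n ·⁺ ⊤⁺    = ⊤⁺

  +⁺-cong : ∀ {X Y Z W} → X ≈⁺ Y → Z ≈⁺ W → X +⁺ Z ≈⁺ Y +⁺ W
  +⁺-cong [ a≈b ] [ c≈d ] = [ ∙-cong a≈b c≈d ]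
  +⁺-cong [ _ ]   ⊤⁺≈⊤⁺   = ⊤⁺≈⊤⁺
  +⁺-cong ⊤⁺≈⊤⁺   _       = ⊤⁺≈⊤⁺

  +⁺-comm : ∀ X Y → X +⁺ Y ≈⁺ Y +⁺ X
  +⁺-comm [ a ] [ b ] = [ comm a b ]
  +⁺-comm [ a ] ⊤⁺    = ⊤⁺≈⊤⁺
  +⁺-comm ⊤⁺    [ b ] = ⊤⁺≈⊤⁺
  +⁺-comm ⊤⁺    ⊤⁺    = ⊤⁺≈⊤⁺

  +⁺-mono-≤⁺ : ∀ {X Y Z W} → X ≤⁺ Y → Z ≤⁺ W → X +⁺ Z ≤⁺ Y +⁺ W
  +⁺-mono-≤⁺ [ a≤b ]   [ c≤d ]   = [ ∙-mono-≤ a≤b c≤d ]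
  +⁺-mono-≤⁺ [ _ ]     (_ ≤⊤⁺)   = _ ≤⊤⁺
  +⁺-mono-≤⁺ (_ ≤⊤⁺)   _         = _ ≤⊤⁺

  +⁺-mono-<⁺-≤⁺ : ∀ {a b Y Z} → [ a ] <⁺ Y → [ b ] ≤⁺ Z → [ a ∙ b ] <⁺ Y +⁺ Z
  +⁺-mono-<⁺-≤⁺ [ a<c ]    [ b≤d ]  = [ ∙-mono-<-≤ a<c b≤d ]
  +⁺-mono-<⁺-≤⁺ [ a<c ]    (_ ≤⊤⁺)  = [ _ ]<⊤⁺
  +⁺-mono-<⁺-≤⁺ [ a ]<⊤⁺   _        = [ _ ]<⊤⁺

  +⁺-mono-≤⁺-<⁺ : ∀ {a b Y Z} → [ a ] ≤⁺ Y → [ b ] <⁺ Z → [ a ∙ b ] <⁺ Y +⁺ Z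
  +⁺-mono-≤⁺-<⁺ {a} {b} {Y} {Z} a≤Y b<Z =
    <⁺-respʳ-≈⁺ (+⁺-comm Z Y) (<⁺-respˡ-≈⁺ [ comm b a ] (+⁺-mono-<⁺-≤⁺ b<Z a≤Y))

  +⁺-cancelʳ-<⁺ : ∀ {X Y} c → X +⁺ [ c ] <⁺ Y +⁺ [ c ] → X <⁺ Y
  +⁺-cancelʳ-<⁺ {[ a ]} {[ b ]} c [ ac<bc ] = [ ∙-cancelʳ-< c ac<bc ]
  +⁺-cancelʳ-<⁺ {[ a ]} {⊤⁺}    c _         = [ a ]<⊤⁺

  +⁺-interchange : ∀ X Y c d → X +⁺ Y +⁺ [ c ∙ d ] ≈⁺ (X +⁺ [ c ]) +⁺ (Y +⁺ [ d ])
  +⁺-interchange [ a ] [ b ] c d = [ interchange a b c d ]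
  +⁺-interchange [ a ] ⊤⁺    c d = ⊤⁺≈⊤⁺
  +⁺-interchange ⊤⁺    Y     c d = ⊤⁺≈⊤⁺

  +⁺-identityˡ : ∀ X → [ ε ] +⁺ X ≈⁺ X
  +⁺-identityˡ [ a ] = [ identityˡ a ]
  +⁺-identityˡ ⊤⁺    = ⊤⁺≈⊤⁺

  ·⁺-cong : ∀ n {X Y} → X ≈⁺ Y → n ·⁺ X ≈⁺ n ·⁺ Y
  ·⁺-cong n [ a≈b ] = [ ·-congʳ n a≈b ]
  ·⁺-cong n ⊤⁺≈⊤⁺   = ⊤⁺≈⊤⁺

  ·⁺-distrib-+⁺ : ∀ n X Y → n ·⁺ (X +⁺ Y) ≈⁺ n ·⁺ X +⁺ n ·⁺ Y
  ·⁺-distrib-+⁺ n [ a ] [ b ] = [ ·-distrib-∙ n a b ]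
  ·⁺-distrib-+⁺ n [ a ] ⊤⁺    = ⊤⁺≈⊤⁺
  ·⁺-distrib-+⁺ n ⊤⁺    Y     = ⊤⁺≈⊤⁺

  ·⁺-mono-≤⁺ : ∀ n {X Y} → X ≤⁺ Y → n ·⁺ X ≤⁺ n ·⁺ Y
  ·⁺-mono-≤⁺ n [ a≤b ] = [ ·-mono-≤ n a≤b ]
  ·⁺-mono-≤⁺ n (X ≤⊤⁺) = _ ≤⊤⁺

  ·⁺-cancel-<⁺ : ∀ n {X Y} → suc n ·⁺ X <⁺ suc n ·⁺ Y → X <⁺ Y
  ·⁺-cancel-<⁺ n {[ a ]} {[ b ]} [ na<nb ] = [ ·-cancel-< n na<nb ]
  ·⁺-cancel-<⁺ n {[ a ]} {⊤⁺}    _         = [ a ]<⊤⁺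

  fromG∞ : G∞ G → Carrier ⁺
  fromG∞ (fin a) = [ a ]
  fromG∞ ∞       = ⊤⁺

  fromG∞-≈ : ∀ {X Y} → _≈∞_ G X Y → fromG∞ X ≈⁺ fromG∞ Y
  fromG∞-≈ {fin a} {fin b} a≈b = [ a≈b ]
  fromG∞-≈ {∞}     {∞}     _   = ⊤⁺≈⊤⁺

  fromG∞-≤ : ∀ {X Y} → _≤∞_ G X Y → fromG∞ X ≤⁺ fromG∞ Y
  fromG∞-≤ {fin a} {fin b} a≤b = [ a≤b ]
  fromG∞-≤ {X}     {∞}     _   = fromG∞ X ≤⊤⁺

  fromG∞-+ : ∀ X Y → fromG∞ (_+∞_ G X Y) ≡ fromG∞ X +⁺ fromG∞ Y
  fromG∞-+ (fin a) (fin b) = ≡.refl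
  fromG∞-+ (fin a) ∞       = ≡.refl
  fromG∞-+ ∞       Y       = ≡.refl

  fromG∞≡[]⇒≈∞ : ∀ {X x y} → fromG∞ X ≡ [ x ] → x ≈ y → _≈∞_ G X (fin y)
  fromG∞≡[]⇒≈∞ {fin x} ≡.refl x≈y = x≈y

  ÷-<ʰ-finite : ∀ X z W → _<ʰ_ G (_÷_ G X z) W → ∃ λ x → fromG∞ X ≡ [ x ]
  ÷-<ʰ-finite (fin x) z W _ = x , ≡.refl

  -- Conditions (ii) and (iii) with the denominators cleared.
  ÷⁺-<ʰ-÷⁺ : ∀ {x} X Y p q → fromG∞ X ≡ [ x ] →
             _<ʰ_ G (_÷_ G X (+ suc p)) (_÷_ G Y (+ suc q)) → [ suc q · x ] <⁺ suc p ·⁺ fromG∞ Y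
  ÷⁺-<ʰ-÷⁺ (fin x) (fin y) p q ≡.refl qx<py = [ qx<py ]
  ÷⁺-<ʰ-÷⁺ (fin x) ∞       p q ≡.refl _     = [ _ ]<⊤⁺

  ÷⁻-<ʰ-÷⁺ : ∀ {x} X Y p q → fromG∞ X ≡ [ x ] →
             _<ʰ_ G (_÷_ G Y -[1+ q ]) (_÷_ G X (+ suc p)) → ∀ z → [ z ] <⁺ suc p ·⁺ fromG∞ Y +⁺ [ suc q · x ∙ z ]
  ÷⁻-<ʰ-÷⁺ (fin x) (fin y) p q ≡.refl py⁻¹<qx z =
    [ <-respʳ-≈ qx+py+z≈ (<-respˡ-≈ z≈ (∙-mono-<-≤ -py<qx (≤-refl {suc p · y ∙ z}))) ]
    where
    -py<qx : ((suc p · y) ⁻¹) <ᵍ (suc q · x)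
    -py<qx = <-respˡ-≈ (·-homo-⁻¹ (suc p) y) py⁻¹<qx
    z≈ : (suc p · y) ⁻¹ ∙ (suc p · y ∙ z) ≈ z
    z≈ = trans (sym (assoc _ _ z)) (trans (∙-congʳ (inverseˡ _)) (identityˡ z))
    qx+py+z≈ : suc q · x ∙ (suc p · y ∙ z) ≈ suc p · y ∙ (suc q · x ∙ z)
    qx+py+z≈ = x∙yz≈y∙xz _ _ z

module PolynomialProperties {c ℓ : Level} (F : Field c ℓ) where
  open Field F

  coeff-beyond : ∀ {d} (p : Poly F d) i → d < i → coeff F p i ≈ 0#
  coeff-beyond {d} p i d<i with i <? suc d
  ... | yes i<1+d = ⊥-elim (ℕ.<⇒≱ d<i (ℕ.≤-pred i<1+d))
  ... | no _      = refl

  coeff-degree : ∀ {d} (p : Poly F d) → HasDegree F d p → ¬ (coeff F p d ≈ 0#)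
  coeff-degree {d} p p≢0 with d <? suc d
  ... | yes _     = p≢0 ∘ ≡.subst (λ i → p i ≈ 0#) (≡.sym (fromℕ-def d))
  ... | no d≮1+d = ⊥-elim (d≮1+d ℕ.≤-refl)

module ValuationProperties {c ℓ g ℓg o : Level} {F : Field c ℓ}
                           {G : OrderedAbelianGroup g ℓg o} (val : Valuation F G) where
  open Valuation val
  open OrderedGroupProperties G
  open ExtendedGroupProperties G
  open PolynomialProperties F
  module F = Field F
  open import Algebra.Properties.Ring F.ring using (-1*x≈-x; -‿involutive; -0#≈0#)

  ν : F.Carrier → Carrier ⁺
  ν a = fromG∞ (v a)

  ν-cong : ∀ {a b} → a F.≈ b → ν a ≈⁺ ν b
  ν-cong a≈b = fromG∞-≈ (v-cong a≈b)

  ν-* : ∀ a b → ν (a F.* b) ≈⁺ ν a +⁺ ν b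
  ν-* a b = ≈⁺-trans (fromG∞-≈ (v-mul a b)) (≈⁺-reflexive (fromG∞-+ (v a) (v b)))

  ν-+ : ∀ a b → ν a ≤⁺ ν (a F.+ b) ⊎ ν b ≤⁺ ν (a F.+ b)
  ν-+ a b with v-add a b
  ... | inj₁ va≤ = inj₁ (fromG∞-≤ va≤)
  ... | inj₂ vb≤ = inj₂ (fromG∞-≤ vb≤)

  ν-0 : ∀ {a} → a F.≈ F.0# → ν a ≈⁺ ⊤⁺
  ν-0 {a} a≈0 = fromG∞-≈ (v-0⇒∞ a a≈0)

  ν-finite : ∀ {a} → ¬ (a F.≈ F.0#) → ∃ λ α → ν a ≡ [ α ]
  ν-finite {a} a≉0 with v a | v-∞⇒0 a
  ... | fin α | _      = α , ≡.refl
  ... | ∞     | ∞⇒a≈0 = ⊥-elim (a≉0 (∞⇒a≈0 _))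

  ν-1 : ν F.1# ≈⁺ [ ε ]
  ν-1 = ≈⁺-trans (≈⁺-reflexive ν1≡[α]) [ α≈ε ]
    where
    α = proj₁ (ν-finite F.1≉0)
    ν1≡[α] = proj₂ (ν-finite F.1≉0)
    [α∙α]≈[α] : [ α ∙ α ] ≈⁺ [ α ]
    [α∙α]≈[α] = begin
      [ α ∙ α ]          ≡⟨ ≡.cong₂ _+⁺_ ν1≡[α] ν1≡[α] ⟨
      ν F.1# +⁺ ν F.1#   ≈⟨ ν-* F.1# F.1# ⟨
      ν (F.1# F.* F.1#)  ≈⟨ ν-cong (F.*-identityˡ F.1#) ⟩
      ν F.1#             ≡⟨ ν1≡[α] ⟩
      [ α ]              ∎
      where open ≈⁺-Reasoning
    α≈ε : α ≈ ε
    α≈ε = ∙-cancelʳ α α ε (trans ([≈]-injective [α∙α]≈[α]) (sym (identityˡ α)))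

  ν-‿ : ∀ a → ν (F.- a) ≈⁺ ν a
  ν-‿ a = begin
    ν (F.- a)            ≈⟨ ν-cong (-1*x≈-x a) ⟨
    ν (F.- F.1# F.* a)   ≈⟨ ν-* (F.- F.1#) a ⟩
    ν (F.- F.1#) +⁺ ν a  ≈⟨ +⁺-cong ν-1≈ε ≈⁺-refl ⟩
    [ ε ] +⁺ ν a         ≈⟨ +⁺-identityˡ (ν a) ⟩
    ν a                  ∎
    where
    open ≈⁺-Reasoning
    -1≉0 : ¬ (F.- F.1# F.≈ F.0#)
    -1≉0 -1≈0 = F.1≉0 (F.trans (F.sym (-‿involutive F.1#)) (F.trans (F.-‿cong -1≈0) -0#≈0#))
    w = proj₁ (ν-finite -1≉0)
    ν-1≡[w] = proj₂ (ν-finite -1≉0)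
    [w∙w]≈[ε] : [ w ∙ w ] ≈⁺ [ ε ]
    [w∙w]≈[ε] = begin
      [ w ∙ w ]                     ≡⟨ ≡.cong₂ _+⁺_ ν-1≡[w] ν-1≡[w] ⟨
      ν (F.- F.1#) +⁺ ν (F.- F.1#)  ≈⟨ ν-* (F.- F.1#) (F.- F.1#) ⟨
      ν (F.- F.1# F.* F.- F.1#)     ≈⟨ ν-cong (F.trans (-1*x≈-x (F.- F.1#)) (-‿involutive F.1#)) ⟩
      ν F.1#                        ≈⟨ ν-1 ⟩
      [ ε ]                         ∎
    ν-1≈ε : ν (F.- F.1#) ≈⁺ [ ε ]
    ν-1≈ε = ≈⁺-trans (≈⁺-reflexive ν-1≡[w]) [ x∙x≈ε⇒x≈ε ([≈]-injective [w∙w]≈[ε]) ]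

  ν-+-strict : ∀ {a b} → ν a <⁺ ν b → ν (a F.+ b) ≈⁺ ν a
  ν-+-strict {a} {b} νa<νb = ≤⁺-antisym upper lower
    where
    lower : ν a ≤⁺ ν (a F.+ b)
    lower with ν-+ a b
    ... | inj₁ νa≤ = νa≤
    ... | inj₂ νb≤ = ≤⁺-trans (<⁺⇒≤⁺ νa<νb) νb≤
    a+b-b≈a : (a F.+ b) F.+ F.- b F.≈ a
    a+b-b≈a = F.trans (F.+-assoc a b (F.- b)) (F.trans (F.+-congˡ (F.-‿inverseʳ b)) (F.+-identityʳ a))
    upper : ν (a F.+ b) ≤⁺ ν a
    upper with ν-+ (a F.+ b) (F.- b)
    ... | inj₁ ≤νa = ≤⁺-trans ≤νa (≤⁺-reflexive (ν-cong a+b-b≈a))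
    ... | inj₂ ≤νa = ⊥-elim (<⁺⇒≱⁺ νa<νb
                       (≤⁺-trans (≤⁺-reflexive (≈⁺-sym (ν-‿ b))) (≤⁺-trans ≤νa (≤⁺-reflexive (ν-cong a+b-b≈a)))))

  ν-sumTo-upwardClosed : ∀ {p} (P : Carrier ⁺ → Set p) → (∀ {X Y} → X ≤⁺ Y → P X → P Y) →
                         ∀ t r → (∀ i → i ≤ r → P (ν (t i))) → P (ν (sumTo F t r))
  ν-sumTo-upwardClosed P upward t zero    P-terms = P-terms 0 z≤n
  ν-sumTo-upwardClosed P upward t (suc r) P-terms with ν-+ (sumTo F t r) (t (suc r))
  ... | inj₁ ≤ν = upward ≤ν (ν-sumTo-upwardClosed P upward t r (λ i i≤r → P-terms i (ℕ.m≤n⇒m≤1+n i≤r)))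
  ... | inj₂ ≤ν = upward ≤ν (P-terms (suc r) ℕ.≤-refl)

  ν-sumTo-unique : ∀ t r s → s ≤ r → (∀ i → i ≤ r → i ≢ s → ν (t s) <⁺ ν (t i)) →
                   ν (sumTo F t r) ≈⁺ ν (t s)
  ν-sumTo-unique t zero    .zero z≤n _ = ≈⁺-refl
  ν-sumTo-unique t (suc r) s     s≤1+r others with s ≟ suc r
  ... | yes ≡.refl = ≈⁺-trans (ν-cong (F.+-comm _ _)) (ν-+-strict (ν-sumTo-upwardClosed
                       (ν (t (suc r)) <⁺_) (λ X≤Y → flip <⁺-≤⁺-trans X≤Y) t r
                       (λ i i≤r → others i (ℕ.m≤n⇒m≤1+n i≤r) (ℕ.<⇒≢ (s≤s i≤r)))))
  ... | no s≢1+r = ≈⁺-trans (ν-+-strict (<⁺-respˡ-≈⁺ (≈⁺-sym IH) (others (suc r) ℕ.≤-refl (s≢1+r ∘ ≡.sym)))) IH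
    where
    IH : ν (sumTo F t r) ≈⁺ ν (t s)
    IH = ν-sumTo-unique t r s (ℕ.≤-pred (ℕ.≤∧≢⇒< s≤1+r s≢1+r))
           (λ i i≤r → others i (ℕ.m≤n⇒m≤1+n i≤r))

  product-degree-≤ : ∀ {n d₁ d₂} (f : Poly F n) (f₁ : Poly F d₁) (f₂ : Poly F d₂) →
             HasDegree F d₁ f₁ → HasDegree F d₂ f₂ → IsProduct F f f₁ f₂ → d₁ + d₂ ≤ n
  product-degree-≤ {n} {d₁} {d₂} f f₁ f₂ f₁≢0 f₂≢0 f≈f₁f₂ with d₁ + d₂ ≤? n
  ... | yes d₁+d₂≤n = d₁+d₂≤n
  ... | no  d₁+d₂≰n = ⊥-elim (⊤⁺≉[] (≈⁺-trans (≈⁺-sym (ν-0 (coeff-beyond f r (ℕ.≰⇒> d₁+d₂≰n))))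
                              (≈⁺-trans (ν-cong (f≈f₁f₂ r)) (≈⁺-trans νsum≈νT νT≈αβ))))
    where
    r = d₁ + d₂
    T : ℕ → F.Carrier
    T i = coeff F f₁ i F.* coeff F f₂ (r ∸ i)
    lead₂ : ¬ (coeff F f₂ (r ∸ d₁) F.≈ F.0#)
    lead₂ rewrite ℕ.m+n∸m≡n d₁ d₂ = coeff-degree f₂ f₂≢0
    α = proj₁ (ν-finite (coeff-degree f₁ f₁≢0))
    β = proj₁ (ν-finite lead₂)
    νT≈αβ : ν (T d₁) ≈⁺ [ α ∙ β ]
    νT≈αβ = ≈⁺-trans (ν-* _ _)
              (≈⁺-reflexive (≡.cong₂ _+⁺_ (proj₂ (ν-finite (coeff-degree f₁ f₁≢0))) (proj₂ (ν-finite lead₂))))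
    T≈0 : ∀ i → i ≤ r → i ≢ d₁ → T i F.≈ F.0#
    T≈0 i i≤r i≢d₁ with ≢⇒<⊎> i≢d₁
    ... | inj₁ i<d₁ = F.trans (F.*-congˡ (coeff-beyond f₂ (r ∸ i) (<⇒<+∸ i<d₁))) (F.zeroʳ _)
    ... | inj₂ d₁<i = F.trans (F.*-congʳ (coeff-beyond f₁ i d₁<i)) (F.zeroˡ _)
    νsum≈νT : ν (sumTo F T r) ≈⁺ ν (T d₁)
    νsum≈νT = ν-sumTo-unique T r d₁ (ℕ.m≤m+n d₁ d₂) λ i i≤r i≢d₁ →
      <⁺-respˡ-≈⁺ (≈⁺-sym νT≈αβ) (<⁺-respʳ-≈⁺ (≈⁺-sym (ν-0 (T≈0 i i≤r i≢d₁))) [ α ∙ β ]<⊤⁺)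
    ⊤⁺≉[] : ¬ (⊤⁺ ≈⁺ [ α ∙ β ])
    ⊤⁺≉[] ()

module SequenceMinimum {g ℓ o : Level} (G : OrderedAbelianGroup g ℓ o) where
  open OrderedGroupProperties G
  open ExtendedGroupProperties G

  <⁺-trichotomy : ∀ X Y → ¬ ¬ (X <⁺ Y ⊎ X ≈⁺ Y ⊎ Y <⁺ X)
  <⁺-trichotomy X Y k = ¬¬-excluded-middle λ
    { (yes X≈Y) → k (inj₂ (inj₁ X≈Y))
    ; (no X≉Y)  → k (Sum.[ inj₁ ∘ ≤⁺∧≉⁺⇒<⁺ X≉Y , inj₂ ∘ inj₂ ∘ ≤⁺∧≉⁺⇒<⁺ (X≉Y ∘ ≈⁺-sym) ]′ (≤⁺-total X Y)) }

  record MinimumUpTo (φ : ℕ → Carrier ⁺) (d : ℕ) (M : Carrier ⁺) (s t : ℕ) : Set (g ⊔ ℓ ⊔ o) where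
    field
      first-value  : φ s ≈⁺ M
      last-value   : φ t ≈⁺ M
      lower-bound  : ∀ i → i ≤ d → M ≤⁺ φ i
      before-first : ∀ i → i < s → M <⁺ φ i
      after-last   : ∀ i → t < i → i ≤ d → M <⁺ φ i

  module _ {φ : ℕ → Carrier ⁺} {d M s t} (m : MinimumUpTo φ d M s t) where
    open MinimumUpTo m

    new-minimum : φ (suc d) <⁺ M → MinimumUpTo φ (suc d) (φ (suc d)) (suc d) (suc d)
    new-minimum φ<M = record
      { first-value  = ≈⁺-refl
      ; last-value   = ≈⁺-refl
      ; lower-bound  = ≤-suc-cases (λ i i≤d → ≤⁺-trans (<⁺⇒≤⁺ φ<M) (lower-bound i i≤d)) ≤⁺-refl
      ; before-first = λ i i<1+d → <⁺-≤⁺-trans φ<M (lower-bound i (ℕ.≤-pred i<1+d))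
      ; after-last   = λ i 1+d<i i≤1+d → ⊥-elim (ℕ.<⇒≱ 1+d<i i≤1+d)
      }

    tied-minimum : φ (suc d) ≈⁺ M → MinimumUpTo φ (suc d) M s (suc d)
    tied-minimum φ≈M = record
      { first-value  = first-value
      ; last-value   = φ≈M
      ; lower-bound  = ≤-suc-cases lower-bound (≤⁺-reflexive (≈⁺-sym φ≈M))
      ; before-first = before-first
      ; after-last   = λ i 1+d<i i≤1+d → ⊥-elim (ℕ.<⇒≱ 1+d<i i≤1+d)
      }

    same-minimum : M <⁺ φ (suc d) → MinimumUpTo φ (suc d) M s t
    same-minimum M<φ = record
      { first-value  = first-value
      ; last-value   = last-value
      ; lower-bound  = ≤-suc-cases lower-bound (<⁺⇒≤⁺ M<φ)
      ; before-first = before-first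
      ; after-last   = λ i t<i i≤1+d → ≤-suc-cases {P = λ i → t < i → M <⁺ φ i}
                         (λ i i≤d t<i → after-last i t<i i≤d) (λ _ → M<φ) i i≤1+d t<i
      }

  minimumUpTo-exists : ∀ φ d → ¬ ¬ (∃ λ M → ∃₂ λ s t → MinimumUpTo φ d M s t)
  minimumUpTo-exists φ zero k = k (φ 0 , 0 , 0 , record
    { first-value  = ≈⁺-refl
    ; last-value   = ≈⁺-refl
    ; lower-bound  = λ { .0 z≤n → ≤⁺-refl }
    ; before-first = λ _ ()
    ; after-last   = λ i 0<i i≤0 → ⊥-elim (ℕ.<⇒≱ 0<i i≤0)
    })
  minimumUpTo-exists φ (suc d) k = minimumUpTo-exists φ d λ (M , s , t , m) →
    <⁺-trichotomy (φ (suc d)) M λ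
      { (inj₁ φ<M)        → k (_ , _ , _ , new-minimum m φ<M)
      ; (inj₂ (inj₁ φ≈M)) → k (_ , _ , _ , tied-minimum m φ≈M)
      ; (inj₂ (inj₂ M<φ)) → k (_ , _ , _ , same-minimum m M<φ)
      }

  record Minimum (φ : ℕ → Carrier ⁺) (M : Carrier) (s t : ℕ) : Set (g ⊔ ℓ ⊔ o) where
    field
      first-value  : φ s ≈⁺ [ M ]
      last-value   : φ t ≈⁺ [ M ]
      lower-bound  : ∀ i → [ M ] ≤⁺ φ i
      before-first : ∀ i → i < s → [ M ] <⁺ φ i
      after-last   : ∀ i → t < i → [ M ] <⁺ φ i

    first≤last : s ≤ t
    first≤last = ℕ.≮⇒≥ λ t<s → <⁺⇒≉⁺ (before-first t t<s) (≈⁺-sym last-value)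

    last≤ : ∀ {d} → (∀ i → d < i → φ i ≈⁺ ⊤⁺) → t ≤ d
    last≤ φ≈⊤ = ℕ.≮⇒≥ λ d<t → ⊤⁺≉[] (≈⁺-trans (≈⁺-sym (φ≈⊤ _ d<t)) last-value)
      where
      ⊤⁺≉[] : ¬ (⊤⁺ ≈⁺ [ M ])
      ⊤⁺≉[] ()

  minimum-exists : ∀ {φ d a} → φ d ≈⁺ [ a ] → (∀ i → d < i → φ i ≈⁺ ⊤⁺) →
                   ¬ ¬ (∃ λ M → ∃₂ λ s t → Minimum φ M s t)
  minimum-exists {φ} {d} {a} φd≈a φ≈⊤ k = minimumUpTo-exists φ d λ
    { (⊤⁺ , s , t , m) → ⊤⁺≰[] (≤⁺-trans (MinimumUpTo.lower-bound m d ℕ.≤-refl) (≤⁺-reflexive φd≈a))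
    ; ([ M ] , s , t , m) → k (M , s , t , extend m)
    }
    where
    ⊤⁺≰[] : ¬ (⊤⁺ ≤⁺ [ a ])
    ⊤⁺≰[] ()
    extend : ∀ {M s t} → MinimumUpTo φ d [ M ] s t → Minimum φ M s t
    extend {M} m = record
      { first-value  = first-value
      ; last-value   = last-value
      ; lower-bound  = λ i → Sum.[ lower-bound i , (λ d<i → ≤⁺-trans ([ M ] ≤⊤⁺) (≤⁺-reflexive (≈⁺-sym (φ≈⊤ i d<i)))) ]′
                               (ℕ.≤-<-connex i d)
      ; before-first = before-first
      ; after-last   = λ i t<i → Sum.[ after-last i t<i , (λ d<i → <⁺-respʳ-≈⁺ (≈⁺-sym (φ≈⊤ i d<i)) [ M ]<⊤⁺) ]′
                                   (ℕ.≤-<-connex i d)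
      }
      where open MinimumUpTo m

  minimum-unique : ∀ {φ M M′ s s′ t t′} → Minimum φ M s t → Minimum φ M′ s′ t′ → s ≡ s′ × t ≡ t′
  minimum-unique m m′ = ℕ.≤-antisym (ℕ.≮⇒≥ (¬before m′ m)) (ℕ.≮⇒≥ (¬before m m′))
                      , ℕ.≤-antisym (ℕ.≮⇒≥ (¬after m m′)) (ℕ.≮⇒≥ (¬after m′ m))
    where
    same-value : ∀ {φ M M′ s s′ t t′} → Minimum φ M s t → Minimum φ M′ s′ t′ → [ M ] ≈⁺ [ M′ ]
    same-value m m′ = ≤⁺-antisym (≤⁺-trans (Minimum.lower-bound m _) (≤⁺-reflexive (Minimum.first-value m′)))
                                 (≤⁺-trans (Minimum.lower-bound m′ _) (≤⁺-reflexive (Minimum.first-value m)))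
    ¬before : ∀ {φ M M′ s s′ t t′} → Minimum φ M s t → Minimum φ M′ s′ t′ → ¬ (s < s′)
    ¬before m m′ s<s′ = <⁺⇒≉⁺ (Minimum.before-first m′ _ s<s′)
                          (≈⁺-sym (≈⁺-trans (Minimum.first-value m) (same-value m m′)))
    ¬after : ∀ {φ M M′ s s′ t t′} → Minimum φ M s t → Minimum φ M′ s′ t′ → ¬ (t′ < t)
    ¬after m m′ t′<t = <⁺⇒≉⁺ (Minimum.after-last m′ _ t′<t)
                          (≈⁺-sym (≈⁺-trans (Minimum.last-value m) (same-value m m′)))

module GroupDivisibility {g ℓ o : Level} (G : OrderedAbelianGroup g ℓ o) where
  open OrderedGroupProperties G
  open import Algebra.Properties.AbelianGroup abelianGroup using (xyx⁻¹≈y)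
  open import Data.Nat.Divisibility using (_∣_; divides; ∣⇒≤)
  open import Data.Nat.GCD using (module Bézout; module GCD)

  infix 4 _∣ᵍ_

  record _∣ᵍ_ (k : ℕ) (z : Carrier) : Set (g ⊔ ℓ) where
    constructor dividesᵍ
    field
      quotient : Carrier
      equality : z ≈ k · quotient

  ∣ᵍ-refl : ∀ k x → k ∣ᵍ k · x
  ∣ᵍ-refl k x = dividesᵍ x refl

  ∣ᵍ-*-· : ∀ {k x} a l → k ∣ᵍ l · x → k ∣ᵍ (a * l) · x
  ∣ᵍ-*-· {k} {x} a l (dividesᵍ y lx≈ky) = dividesᵍ (a · y) (begin
    (a * l) · x  ≈⟨ ·-assocˡ x a l ⟨
    a · (l · x)  ≈⟨ ·-congʳ a lx≈ky ⟩
    a · (k · y)  ≈⟨ ·-comm y a k ⟩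
    k · (a · y)  ∎)
    where open ≈-Reasoning

  ∣ᵍ-+-cancelʳ : ∀ {k x} e b → k ∣ᵍ (e + b) · x → k ∣ᵍ b · x → k ∣ᵍ e · x
  ∣ᵍ-+-cancelʳ {k} {x} e b (dividesᵍ y e+b≈ky) (dividesᵍ y′ b≈ky′) = dividesᵍ (y ∙ y′ ⁻¹) (begin
    e · x                       ≈⟨ xyx⁻¹≈y (b · x) (e · x) ⟨
    b · x ∙ e · x ∙ (b · x) ⁻¹  ≈⟨ ∙-congʳ (trans (comm _ _) (sym (·-homo-+ x e b))) ⟩
    (e + b) · x ∙ (b · x) ⁻¹    ≈⟨ ∙-cong e+b≈ky (⁻¹-cong b≈ky′) ⟩
    k · y ∙ (k · y′) ⁻¹         ≈⟨ ∙-congˡ (·-homo-⁻¹ k y′) ⟨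
    k · y ∙ k · (y′ ⁻¹)         ≈⟨ ·-distrib-∙ k y (y′ ⁻¹) ⟨
    k · (y ∙ y′ ⁻¹)             ∎)
    where open ≈-Reasoning

  ∣ᵍ-gcd : ∀ {l m x} → m ∣ᵍ l · x → 0 < l → l < m → ¬ ¬ (∃ λ q → q ∣ m × 1 < q × q ∣ᵍ x)
  ∣ᵍ-gcd {l} {m} {x} m∣lx 0<l l<m with Bézout.lemma l m
  ... | Bézout.result d gcd identity =
    divisor (m∣dx identity) (GCD.gcd∣n gcd) (ℕ.≤-<-trans (∣⇒≤ {{>-nonZero 0<l}} (GCD.gcd∣m gcd)) l<m)
    where
    m∣dx : ∀ {d} → Bézout.Identity d l m → m ∣ᵍ d · x
    m∣dx {d} (Bézout.+- a b d+bm≡al) = ∣ᵍ-+-cancelʳ d (b * m)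
      (≡.subst (λ n → m ∣ᵍ n · x) (≡.sym d+bm≡al) (∣ᵍ-*-· a l m∣lx)) (∣ᵍ-*-· b m (∣ᵍ-refl m x))
    m∣dx {d} (Bézout.-+ a b d+al≡bm) = ∣ᵍ-+-cancelʳ d (a * l)
      (≡.subst (λ n → m ∣ᵍ n · x) (≡.sym d+al≡bm) (∣ᵍ-*-· b m (∣ᵍ-refl m x))) (∣ᵍ-*-· a l m∣lx)

    divisor : ∀ {d} → m ∣ᵍ d · x → d ∣ m → d < m → ¬ ¬ (∃ λ q → q ∣ m × 1 < q × q ∣ᵍ x)
    divisor {zero}   _ (divides q m≡q*0) _ _ =
      ℕ.<⇒≢ (ℕ.<-trans 0<l l<m) (≡.sym (≡.trans m≡q*0 (ℕ.*-zeroʳ q)))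
    divisor {suc d′} (dividesᵍ y dx≈my) (divides q m≡qd) d<m k = ·-cancel-≈ d′ dx≈dqy λ x≈qy →
      k (q , divides (suc d′) (≡.trans m≡qd (ℕ.*-comm q (suc d′))) , 1<q , dividesᵍ y x≈qy)
      where
      dx≈dqy : suc d′ · x ≈ suc d′ · (q · y)
      dx≈dqy = trans dx≈my (trans (·-congˡ y m≡qd) (trans (sym (·-assocˡ y q (suc d′))) (·-comm y q (suc d′))))
      1<q : 1 < q
      1<q = ℕ.≰⇒> λ q≤1 → ℕ.<⇒≱ d<m (≡.subst (_≤ suc d′) (≡.sym m≡qd)
              (≡.subst (q * suc d′ ≤_) (ℕ.*-identityˡ (suc d′)) (ℕ.*-monoˡ-≤ (suc d′) q≤1)))

  ∣ᵍ-difference : ∀ {k α β s l x} → k · α ∙ s · x ≈ k · β ∙ (s + l) · x → k ∣ᵍ l · x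
  ∣ᵍ-difference {k} {α} {β} {s} {l} {x} eq = dividesᵍ (α ∙ β ⁻¹) (begin
    l · x                       ≈⟨ xyx⁻¹≈y (k · β) (l · x) ⟨
    k · β ∙ l · x ∙ (k · β) ⁻¹  ≈⟨ ∙-congʳ kβ+lx≈kα ⟩
    k · α ∙ (k · β) ⁻¹          ≈⟨ ∙-congˡ (·-homo-⁻¹ k β) ⟨
    k · α ∙ k · (β ⁻¹)          ≈⟨ ·-distrib-∙ k α (β ⁻¹) ⟨
    k · (α ∙ β ⁻¹)              ∎)
    where
    open ≈-Reasoning
    kβ+lx≈kα : k · β ∙ l · x ≈ k · α
    kβ+lx≈kα = ∙-cancelʳ (s · x) _ _ (begin
      k · β ∙ l · x ∙ s · x    ≈⟨ assoc (k · β) (l · x) (s · x) ⟩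
      k · β ∙ (l · x ∙ s · x)  ≈⟨ ∙-congˡ (trans (comm _ _) (sym (·-homo-+ x s l))) ⟩
      k · β ∙ (s + l) · x      ≈⟨ eq ⟨
      k · α ∙ s · x            ∎)

module NewtonWeights {c ℓ g ℓg o : Level} {F : Field c ℓ} {G : OrderedAbelianGroup g ℓg o}
                     (val : Valuation F G) (p : ℕ) (x : OrderedAbelianGroup.Carrier G) where
  open OrderedGroupProperties G
  open ExtendedGroupProperties G
  open ValuationProperties val
  open SequenceMinimum G
  open GroupDivisibility G

  m : ℕ
  m = suc p

  weight : F.Carrier → ℕ → Carrier ⁺
  weight a i = m ·⁺ ν a +⁺ [ i · x ]

  weights : (ℕ → F.Carrier) → ℕ → Carrier ⁺
  weights f i = weight (f i) i

  weight-cong : ∀ {a b} i → a F.≈ b → weight a i ≈⁺ weight b i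
  weight-cong i a≈b = +⁺-cong (·⁺-cong m (ν-cong a≈b)) ≈⁺-refl

  weight-0 : ∀ {a} i → a F.≈ F.0# → weight a i ≈⁺ ⊤⁺
  weight-0 i a≈0 = +⁺-cong (·⁺-cong m (ν-0 a≈0)) (≈⁺-refl {[ i · x ]})

  weight-* : ∀ a b i j → weight (a F.* b) (i + j) ≈⁺ weight a i +⁺ weight b j
  weight-* a b i j = begin
    m ·⁺ ν (a F.* b) +⁺ [ (i + j) · x ]        ≈⟨ +⁺-cong (·⁺-cong m (ν-* a b)) [ ·-homo-+ x i j ] ⟩
    m ·⁺ (ν a +⁺ ν b) +⁺ [ i · x ∙ j · x ]     ≈⟨ +⁺-cong (·⁺-distrib-+⁺ m (ν a) (ν b)) ≈⁺-refl ⟩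
    m ·⁺ ν a +⁺ m ·⁺ ν b +⁺ [ i · x ∙ j · x ]  ≈⟨ +⁺-interchange (m ·⁺ ν a) (m ·⁺ ν b) (i · x) (j · x) ⟩
    weight a i +⁺ weight b j                   ∎
    where open ≈⁺-Reasoning

  weight-sumTo-upwardClosed : ∀ {q} (P : Carrier ⁺ → Set q) → (∀ {X Y} → X ≤⁺ Y → P X → P Y) →
                              ∀ t r → (∀ i → i ≤ r → P (weight (t i) r)) → P (weight (sumTo F t r) r)
  weight-sumTo-upwardClosed P upward t r =
    ν-sumTo-upwardClosed (λ Y → P (m ·⁺ Y +⁺ [ r · x ]))
                         (λ X≤Y → upward (+⁺-mono-≤⁺ (·⁺-mono-≤⁺ m X≤Y) ≤⁺-refl)) t r

  weight-sumTo-unique : ∀ t r s → s ≤ r → (∀ i → i ≤ r → i ≢ s → weight (t s) r <⁺ weight (t i) r) →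
                        weight (sumTo F t r) r ≈⁺ weight (t s) r
  weight-sumTo-unique t r s s≤r others = +⁺-cong (·⁺-cong m (ν-sumTo-unique t r s s≤r
    (λ i i≤r i≢s → ·⁺-cancel-<⁺ p (+⁺-cancelʳ-<⁺ (r · x) (others i i≤r i≢s))))) ≈⁺-refl

  module _ {f f₁ f₂ : ℕ → F.Carrier} (f≈f₁f₂ : ∀ r → f r F.≈ sumTo F (λ i → f₁ i F.* f₂ (r ∸ i)) r)
           {M₁ M₂ s₁ s₂ t₁ t₂} (min₁ : Minimum (weights f₁) M₁ s₁ t₁) (min₂ : Minimum (weights f₂) M₂ s₂ t₂)
           where
    private
      module min₁ = Minimum min₁
      module min₂ = Minimum min₂

      term : ℕ → ℕ → F.Carrier
      term r i = f₁ i F.* f₂ (r ∸ i)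

      weight-term : ∀ {r i} → i ≤ r → weight (term r i) r ≈⁺ weights f₁ i +⁺ weights f₂ (r ∸ i)
      weight-term {r} {i} i≤r = ≈⁺-trans (≈⁺-reflexive (≡.cong (weight (term r i)) (≡.sym (ℕ.m+[n∸m]≡n i≤r))))
                                          (weight-* (f₁ i) (f₂ (r ∸ i)) i (r ∸ i))

      Side : ℕ → ℕ → Set _
      Side r i = [ M₁ ] <⁺ weights f₁ i ⊎ [ M₂ ] <⁺ weights f₂ (r ∸ i)

      weight-term-strict : ∀ {r i} → i ≤ r → Side r i → [ M₁ ∙ M₂ ] <⁺ weight (term r i) r
      weight-term-strict i≤r side = <⁺-respʳ-≈⁺ (≈⁺-sym (weight-term i≤r)) (Sum.[
        (λ M₁< → +⁺-mono-<⁺-≤⁺ M₁< (min₂.lower-bound _)) ,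
        (λ M₂< → +⁺-mono-≤⁺-<⁺ (min₁.lower-bound _) M₂<) ]′ side)

      lower-bound : ∀ r → [ M₁ ∙ M₂ ] ≤⁺ weights f r
      lower-bound r = ≤⁺-trans
        (weight-sumTo-upwardClosed ([ M₁ ∙ M₂ ] ≤⁺_) (flip ≤⁺-trans) (term r) r λ i i≤r →
          ≤⁺-trans (+⁺-mono-≤⁺ (min₁.lower-bound i) (min₂.lower-bound (r ∸ i)))
                   (≤⁺-reflexive (≈⁺-sym (weight-term i≤r))))
        (≤⁺-reflexive (weight-cong r (F.sym (f≈f₁f₂ r))))

      strictly-above : ∀ {r} → (∀ i → i ≤ r → Side r i) → [ M₁ ∙ M₂ ] <⁺ weights f r
      strictly-above {r} sides = <⁺-respʳ-≈⁺ (weight-cong r (F.sym (f≈f₁f₂ r)))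
        (weight-sumTo-upwardClosed ([ M₁ ∙ M₂ ] <⁺_) (flip <⁺-≤⁺-trans) (term r) r λ i i≤r →
          weight-term-strict i≤r (sides i i≤r))

      attained : ∀ {r s} → s ≤ r → weights f₁ s ≈⁺ [ M₁ ] → weights f₂ (r ∸ s) ≈⁺ [ M₂ ] →
                 (∀ i → i ≤ r → i ≢ s → Side r i) → weights f r ≈⁺ [ M₁ ∙ M₂ ]
      attained {r} {s} s≤r f₁s≈M₁ f₂≈M₂ sides = begin
        weights f r                    ≈⟨ weight-cong r (f≈f₁f₂ r) ⟩
        weight (sumTo F (term r) r) r  ≈⟨ weight-sumTo-unique (term r) r s s≤r (λ i i≤r i≢s →
                                            <⁺-respˡ-≈⁺ (≈⁺-sym term-s≈M)
                                                        (weight-term-strict i≤r (sides i i≤r i≢s))) ⟩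
        weight (term r s) r            ≈⟨ term-s≈M ⟩
        [ M₁ ∙ M₂ ]                    ∎
        where
        open ≈⁺-Reasoning
        term-s≈M : weight (term r s) r ≈⁺ [ M₁ ∙ M₂ ]
        term-s≈M = ≈⁺-trans (weight-term s≤r) (+⁺-cong f₁s≈M₁ f₂≈M₂)

    product-minimum : Minimum (weights f) (M₁ ∙ M₂) (s₁ + s₂) (t₁ + t₂)
    product-minimum = record
      { first-value  = attained (ℕ.m≤m+n s₁ s₂) min₁.first-value
                         (≈⁺-trans (≈⁺-reflexive (≡.cong (weights f₂) (ℕ.m+n∸m≡n s₁ s₂))) min₂.first-value)
                         λ i i≤ i≢s₁ → Sum.map (min₁.before-first i) (λ s₁<i → min₂.before-first _ (>⇒+∸< s₁<i i≤))
                                         (≢⇒<⊎> i≢s₁)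
      ; last-value   = attained (ℕ.m≤m+n t₁ t₂) min₁.last-value
                         (≈⁺-trans (≈⁺-reflexive (≡.cong (weights f₂) (ℕ.m+n∸m≡n t₁ t₂))) min₂.last-value)
                         λ i i≤ i≢t₁ → Sum.swap (Sum.map (λ i<t₁ → min₂.after-last _ (<⇒<+∸ i<t₁))
                                                         (min₁.after-last i) (≢⇒<⊎> i≢t₁))
      ; lower-bound  = lower-bound
      ; before-first = λ r r<s → strictly-above λ i i≤r →
                         Sum.map (min₁.before-first i) (min₂.before-first _) (split-below i≤r r<s)
      ; after-last   = λ r t<r → strictly-above λ i i≤r →
                         Sum.map (min₁.after-last i) (min₂.after-last _) (split-above i≤r t<r)
      }

  weight-finite : ∀ {a i N} → m ·⁺ ν a +⁺ [ i · x ] ≈⁺ [ N ] → ∃ λ α → m · α ∙ i · x ≈ N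
  weight-finite {a} eq with ν a
  weight-finite [ eq ] | [ α ] = α , eq

  minimum-∣ᵍ : ∀ {f M s t} → Minimum (weights f) M s t → m ∣ᵍ (t ∸ s) · x
  minimum-∣ᵍ {f} {s = s} {t} min
    with weight-finite {f s} {s} (Minimum.first-value min) | weight-finite {f t} {t} (Minimum.last-value min)
  ... | α , mα+sx≈M | β , mβ+tx≈M =
    ∣ᵍ-difference {s = s} {x = x} (trans mα+sx≈M (sym (trans (∙-congˡ s+l≡t) mβ+tx≈M)))
    where
    s+l≡t : (s + (t ∸ s)) · x ≈ t · x
    s+l≡t = ·-congˡ x (ℕ.m+[n∸m]≡n (Minimum.first≤last min))

  weights-minimum-exists : ∀ {d} (q : Poly F d) → HasDegree F d q →
                    ¬ ¬ (∃ λ M → ∃₂ λ s t → t ≤ d × Minimum (weights (coeff F q)) M s t)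
  weights-minimum-exists {d} q q≢0 ¬min = minimum-exists {a = m · α ∙ d · x} weight-d beyond λ (M , s , t , min) →
    ¬min (M , s , t , Minimum.last≤ min beyond , min)
    where
    open PolynomialProperties F
    α = proj₁ (ν-finite (coeff-degree q q≢0))
    weight-d : weights (coeff F q) d ≈⁺ [ m · α ∙ d · x ]
    weight-d = ≈⁺-reflexive (≡.cong (λ X → m ·⁺ X +⁺ [ d · x ]) (proj₂ (ν-finite (coeff-degree q q≢0))))
    beyond : ∀ i → d < i → weights (coeff F q) i ≈⁺ ⊤⁺
    beyond i d<i = weight-0 i (coeff-beyond q i d<i)

module NewtonEdge {c ℓ g ℓg o : Level} {F : Field c ℓ} {G : OrderedAbelianGroup g ℓg o}
                  (val : Valuation F G) where
  open Valuation val
  open OrderedGroupProperties G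
  open ExtendedGroupProperties G
  open ValuationProperties val
  open PolynomialProperties F
  open SequenceMinimum G

  conditions⇒minimum : ∀ {n j k p x} {f : Poly F n} → Conditions val n f j k → suc p + k ≡ j →
                        ν (coeff F f k) ≡ [ x ] → Minimum (NewtonWeights.weights val p x (coeff F f)) (j · x) k j
  conditions⇒minimum {n} {j} {k} {p} {x} {f} (k<j , j≤n , v[aj]≈0 , ii , iii , _) m+k≡j ν[ak]≡x = record
    { first-value  = first-value
    ; last-value   = last-value
    ; lower-bound  = lower-bound
    ; before-first = λ i i<k → strict i (ℕ.<⇒≢ i<k) (ℕ.<⇒≢ (ℕ.<-trans i<k k<j))
    ; after-last   = λ i j<i → strict i (ℕ.>⇒≢ (ℕ.<-trans k<j j<i)) (ℕ.>⇒≢ j<i)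
    }
    where
    open NewtonWeights val p x
    a = coeff F f

    first-value : weights a k ≈⁺ [ j · x ]
    first-value = begin
      m ·⁺ ν (a k) +⁺ [ k · x ]  ≡⟨ ≡.cong (λ X → m ·⁺ X +⁺ [ k · x ]) ν[ak]≡x ⟩
      [ m · x ∙ k · x ]          ≈⟨ [ ·-homo-+ x m k ] ⟨
      [ (m + k) · x ]            ≡⟨ ≡.cong (λ i → [ i · x ]) m+k≡j ⟩
      [ j · x ]                  ∎
      where open ≈⁺-Reasoning

    last-value : weights a j ≈⁺ [ j · x ]
    last-value = begin
      m ·⁺ ν (a j) +⁺ [ j · x ]  ≈⟨ +⁺-cong (·⁺-cong m (fromG∞-≈ v[aj]≈0)) ≈⁺-refl ⟩
      [ m · ε ∙ j · x ]          ≈⟨ [ trans (∙-congʳ (·-zeroʳ m)) (identityˡ (j · x)) ] ⟩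
      [ j · x ]                  ∎
      where open ≈⁺-Reasoning

    below : ∀ {i} → i < j → i ≢ k → [ j · x ] <⁺ weights a i
    below {i} i<j i≢k = <⁺-respˡ-≈⁺ [ trans (sym (·-homo-+ x (suc q) i)) (·-congˡ x 1+q+i≡j) ]
      (+⁺-mono-<⁺-≤⁺ (÷⁺-<ʰ-÷⁺ (v (a k)) (v (a i)) p q ν[ak]≡x
                       (≡.subst₂ (λ z z′ → _<ʰ_ G (_÷_ G (v (a k)) z) (_÷_ G (v (a i)) z′))
                                 (⊖-pos m+k≡j) (⊖-pos 1+q+i≡j) (ii i i<j i≢k)))
                     ≤⁺-refl)
      where
      q = j ∸ suc i
      1+q+i≡j = suc[∸suc]+≡ i<j

    above : ∀ {i} → j < i → i ≤ n → [ j · x ] <⁺ weights a i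
    above {i} j<i i≤n = <⁺-respʳ-≈⁺ (+⁺-cong ≈⁺-refl [ trans (sym (·-homo-+ x (suc q) j)) (·-congˡ x 1+q+j≡i) ])
      (÷⁻-<ʰ-÷⁺ (v (a k)) (v (a i)) p q ν[ak]≡x
                (≡.subst₂ (λ z z′ → _<ʰ_ G (_÷_ G (v (a i)) z) (_÷_ G (v (a k)) z′))
                          (⊖-neg 1+q+j≡i) (⊖-pos m+k≡j) (iii (ℕ.<-≤-trans j<i i≤n) i j<i i≤n))
                (j · x))
      where
      q = i ∸ suc j
      1+q+j≡i = suc[∸suc]+≡ j<i

    strict : ∀ i → i ≢ k → i ≢ j → [ j · x ] <⁺ weights a i
    strict i i≢k i≢j with ≢⇒<⊎> i≢j | i ≤? n
    ... | inj₁ i<j | _       = below i<j i≢k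
    ... | inj₂ j<i | yes i≤n = above j<i i≤n
    ... | inj₂ _   | no  i≰n = <⁺-respʳ-≈⁺ (≈⁺-sym (weight-0 i (coeff-beyond f i (ℕ.≰⇒> i≰n)))) [ j · x ]<⊤⁺

    lower-bound : ∀ i → [ j · x ] ≤⁺ weights a i
    lower-bound i with i ≟ k | i ≟ j
    ... | yes ≡.refl | _          = ≤⁺-reflexive (≈⁺-sym first-value)
    ... | no  _      | yes ≡.refl = ≤⁺-reflexive (≈⁺-sym last-value)
    ... | no  i≢k    | no  i≢j    = <⁺⇒≤⁺ (strict i i≢k i≢j)

  factor-degrees : ∀ {n j k} {f : Poly F n} → Conditions val n f j k →
                   ∀ {d₁ d₂} (f₁ : Poly F d₁) (f₂ : Poly F d₂) → HasDegree F d₁ f₁ → HasDegree F d₂ f₂ →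
                   IsProduct F f f₁ f₂ → ¬ ¬ (d₁ ≤ n ∸ j + k ⊎ d₂ ≤ n ∸ j + k)
  factor-degrees {n} {j} {k} {f} cond@(k<j , j≤n , _ , ii , _ , iv) {d₁} {d₂} f₁ f₂ f₁≢0 f₂≢0 f≈f₁f₂ =
    by-edge-length (j ∸ suc k) (suc[∸suc]+≡ k<j)
    where
    a = coeff F f
    d₁+d₂≤n : d₁ + d₂ ≤ n
    d₁+d₂≤n = product-degree-≤ f f₁ f₂ f₁≢0 f₂≢0 f≈f₁f₂
    Goal = d₁ ≤ n ∸ j + k ⊎ d₂ ≤ n ∸ j + k

    by-newton-polygon : ∀ p x → suc p + k ≡ j → ν (a k) ≡ [ x ] → ¬ ¬ Goal
    by-newton-polygon p x m+k≡j ν[ak]≡x ¬goal =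
      weights-minimum-exists f₁ f₁≢0 λ (M₁ , s₁ , t₁ , t₁≤d₁ , min₁) →
      weights-minimum-exists f₂ f₂≢0 λ (M₂ , s₂ , t₂ , t₂≤d₂ , min₂) →
      let k≡s₁+s₂ , j≡t₁+t₂ = minimum-unique (conditions⇒minimum cond m+k≡j ν[ak]≡x)
                                              (product-minimum f≈f₁f₂ min₁ min₂)
      in conclude (t₁ ∸ s₁) (t₂ ∸ s₂)
           (≡.trans (≡.sym (∸-distrib-+ (Minimum.first≤last min₁) (Minimum.first≤last min₂)))
             (≡.trans (≡.cong₂ _∸_ (≡.sym j≡t₁+t₂) (≡.sym k≡s₁+s₂)) j∸k≡m))
           (ℕ.≤-trans (ℕ.m∸n≤m t₁ s₁) t₁≤d₁) (ℕ.≤-trans (ℕ.m∸n≤m t₂ s₂) t₂≤d₂) (minimum-∣ᵍ min₁) ¬goal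
      where
      open NewtonWeights val p x
      open GroupDivisibility G
      open import Data.Nat.Divisibility using (_∣_)
      j∸k≡m : j ∸ k ≡ m
      j∸k≡m = ≡.trans (≡.cong (_∸ k) (≡.sym m+k≡j)) (ℕ.m+n∸n≡m m k)
      conclude : ∀ l₁ l₂ → l₁ + l₂ ≡ m → l₁ ≤ d₁ → l₂ ≤ d₂ → m ∣ᵍ l₁ · x → ¬ ¬ Goal
      conclude zero     l₂       l₂≡m     _     l₂≤d₂ _      ¬goal =
        ¬goal (inj₁ (degree-bound d₁+d₂≤n m+k≡j j≤n (≡.subst (_≤ d₂) l₂≡m l₂≤d₂)))
      conclude (suc l₁) zero     l₁+0≡m   l₁≤d₁ _     _      ¬goal =
        ¬goal (inj₂ (degree-bound (≡.subst (_≤ n) (ℕ.+-comm d₁ d₂) d₁+d₂≤n) m+k≡j j≤n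
                      (≡.subst (_≤ d₁) (≡.trans (≡.sym (ℕ.+-identityʳ (suc l₁))) l₁+0≡m) l₁≤d₁)))
      conclude (suc l₁) (suc l₂) l₁+l₂≡m _     _     m∣l₁x ¬goal =
        ∣ᵍ-gcd m∣l₁x (s≤s z≤n) (≡.subst (suc l₁ <_) l₁+l₂≡m (ℕ.m<m+n (suc l₁) (s≤s z≤n)))
          λ (q , q∣m , 1<q , dividesᵍ γ x≈qγ) →
            iv q (≡.subst (q ∣_) (≡.sym j∸k≡m) q∣m) 1<q (γ , fromG∞≡[]⇒≈∞ ν[ak]≡x x≈qγ)

    -- For m = 1 the bound is degree counting; for m ≥ 2, condition (ii) at an index other than k
    -- forces v(a_k) to be finite.
    by-edge-length : ∀ p → suc p + k ≡ j → ¬ ¬ Goal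
    by-edge-length zero     1+k≡j ¬goal with 1 ≤? d₂
    ... | yes 1≤d₂ = ¬goal (inj₁ (degree-bound d₁+d₂≤n 1+k≡j j≤n 1≤d₂))
    ... | no  1≰d₂ = ¬goal (inj₂ (ℕ.≤-trans (ℕ.≤-pred (ℕ.≰⇒> 1≰d₂)) z≤n))
    by-edge-length (suc p) m+k≡j =
      let i , i<j , i≢k = other-index (≡.subst (suc k <_) m+k≡j (s≤s (s≤s (ℕ.m≤n+m k p))))
          x , ν[ak]≡x = ÷-<ʰ-finite (v (a k)) _ _ (ii i i<j i≢k)
      in by-newton-polygon (suc p) x m+k≡j ν[ak]≡x

theorem1 : ∀ {c ℓ g ℓg o : Level} (F : Field c ℓ) (G : OrderedAbelianGroup g ℓg o)
    (val : Valuation F G) (n : ℕ) (f : Poly F n) → HasDegree F n f →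
    (j k : ℕ) → Smallest val n f j k →
    (∀ d₁ (f₁ : Poly F d₁) d₂ (f₂ : Poly F d₂) →
    HasDegree F d₁ f₁ → HasDegree F d₂ f₂ → IsProduct F f f₁ f₂ →
    (d₁ ≤ n ∸ j + k) ⊎ (d₂ ≤ n ∸ j + k))
    × (j ≡ n → k ≡ 0 → Irreducible F n f)
theorem1 F G val n f _ j k (conditions , _) = small-factor , irreducible
  where
  open NewtonEdge val
  small-factor : ∀ d₁ (f₁ : Poly F d₁) d₂ (f₂ : Poly F d₂) →
                 HasDegree F d₁ f₁ → HasDegree F d₂ f₂ → IsProduct F f f₁ f₂ →
                 (d₁ ≤ n ∸ j + k) ⊎ (d₂ ≤ n ∸ j + k)
  small-factor d₁ f₁ d₂ f₂ f₁≢0 f₂≢0 f≈f₁f₂ = decidable-stable (d₁ ≤? n ∸ j + k ⊎-dec d₂ ≤? n ∸ j + k)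
    (factor-degrees conditions f₁ f₂ f₁≢0 f₂≢0 f≈f₁f₂)
  irreducible : j ≡ n → k ≡ 0 → Irreducible F n f
  irreducible ≡.refl ≡.refl = proj₁ conditions , λ d₁ f₁ d₂ f₂ f₁≢0 f₂≢0 f≈f₁f₂ →
    Sum.map ≤0⇒≡0 ≤0⇒≡0 (small-factor d₁ f₁ d₂ f₂ f₁≢0 f₂≢0 f≈f₁f₂)
    where
    ≤0⇒≡0 : ∀ {d} → d ≤ j ∸ j + 0 → d ≡ 0
    ≤0⇒≡0 {d} = ℕ.n≤0⇒n≡0 ∘ ≡.subst (d ≤_) (≡.trans (ℕ.+-identityʳ (j ∸ j)) (ℕ.n∸n≡0 j))
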